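{- Let $(\vec\Gamma_n,v_n)$ be a sequence of rooted oriented graphs converging to $(\vec\Gamma,v)$, and $(\vec\Theta_m,y_m)$ a sequence converging to $(\vec\Theta,y)$, in the space of connected rooted oriented graphs. Denote by $(\vec\Delta,w)^0$ the connected component of $w$ in $\vec\Delta$, rooted at $w$. Then: for each fixed $m$, $(\vec\Gamma_n\otimes\vec\Theta_m,(v_n,y_m))^0\to(\vec\Gamma\otimes\vec\Theta_m,(v,y_m))^0$ as $n\to\infty$; for each fixed $n$, $(\vec\Gamma_n\otimes\vec\Theta_m,(v_n,y_m))^0\to(\vec\Gamma_n\otimes\vec\Theta,(v_n,y))^0$ as $m\to\infty$; $(\vec\Gamma\otimes\vec\Theta_m,(v,y_m))^0\to(\vec\Gamma\otimes\vec\Theta,(v,y))^0$ as $m\to\infty$; $(\vec\Gamma_n\otimes\vec\Theta,(v_n,y))^0\to(\vec\Gamma\otimes\vec\Theta,(v,y))^0$ as $n\to\infty$; and $(\vec\Gamma_n\otimes\vec\Theta_m,(v_n,y_m))^0\to(\vec\Gamma\otimes\vec\Theta,(v,y))^0$ as $n,m\to\infty$ simultaneously.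
   Context: Oriented graphs have vertices, edges and maps $\iota,\tau$; loops and multiple edges allowed; connectedness is in the non-oriented sense. The tensor product $\vec\Gamma\otimes\vec\Delta$ has vertex set $V(\vec\Gamma)\times V(\vec\Delta)$ and an edge $(e,f)$ from $(v_1,w_1)$ to $(v_2,w_2)$ for each edge $e\colon v_1\to v_2$ of $\vec\Gamma$ and $f\colon w_1\to w_2$ of $\vec\Delta$. The space of connected rooted oriented graphs (up to rooted isomorphism) carries the distance $d((\vec\Gamma,v),(\vec\Delta,w))=1/(1+r)$, where $r$ is the largest integer such that the balls of radius $r$ around $v$ and $w$ (balls taken in the underlying non-oriented graph, keeping the orientation of edges) are isomorphic as rooted oriented graphs. -}

module Defs where

open import Data.Nat using (ℕ; zero; suc; _≤_; z≤n)
open import Data.Product using (Σ; _×_; _,_; proj₁; proj₂; ∃)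
open import Data.Sum using (_⊎_)
open import Data.Irrelevant as Irr using (Irrelevant; [_])
open import Data.Refinement using (Refinement; value; proof; _,_)
open import Function.Bundles using (_↔_; Inverse)
open import Relation.Binary.PropositionalEquality using (_≡_)

-- Oriented graphs: vertices, edges, ι (origin), τ (terminus).
-- Loops and multiple edges allowed; no finiteness assumption.

record Graph : Set₁ where
  field
    V : Set
    E : Set
    ι : E → V
    τ : E → V
open Graph public

record RootedGraph : Set₁ where
  field
    graph : Graph
    root  : V graph
open RootedGraph public

-- Underlying non-oriented graph: a step from x to y is an edge traversed
-- forwards or backwards.

Step : (G : Graph) → V G → V G → Set
Step G x y = Σ (E G) (λ e → (ι G e ≡ x × τ G e ≡ y) ⊎ (τ G e ≡ x × ι G e ≡ y))

data Walk (G : Graph) (x : V G) : V G → Set where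
  nil  : Walk G x x
  snoc : ∀ {y z} → Walk G x y → Step G y z → Walk G x z

length : ∀ {G x y} → Walk G x y → ℕ
length nil        = zero
length (snoc w _) = suc (length w)

Reachable : (G : Graph) → V G → V G → Set
Reachable G x y = Walk G x y

DistLE : (G : Graph) → V G → V G → ℕ → Set
DistLE G x y r = Σ (Walk G x y) (λ w → length w ≤ r)

Connected : Graph → Set
Connected G = ∀ x y → Reachable G x y

record _≅_ (G H : RootedGraph) : Set where
  field
    vIso  : V (graph G) ↔ V (graph H)
    eIso  : E (graph G) ↔ E (graph H)
    ι-hom : ∀ e → ι (graph H) (Inverse.to eIso e) ≡ Inverse.to vIso (ι (graph G) e)
    τ-hom : ∀ e → τ (graph H) (Inverse.to eIso e) ≡ Inverse.to vIso (τ (graph G) e)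
    root-hom : Inverse.to vIso (root G) ≡ root H

-- Proofs are irrelevant (Refinement), so these are genuine subsets.

Ball : ℕ → RootedGraph → RootedGraph
Ball r G = record
  { graph = record
      { V = Refinement (V g) (λ x → DistLE g o x r)
      ; E = Refinement (E g) (λ e → DistLE g o (ι g e) r × DistLE g o (τ g e) r)
      ; ι = λ e → ι g (value e) , Irr.map proj₁ (proof e)
      ; τ = λ e → τ g (value e) , Irr.map proj₂ (proof e)
      }
  ; root = o , [ nil , z≤n ]
  }
  where
    g = graph G
    o = root G

extend : (G : Graph) (o : V G) (e : E G) → Reachable G o (ι G e) → Reachable G o (τ G e)
extend G o e w = snoc w (e , Data.Sum.inj₁ (_≡_.refl , _≡_.refl))
  where import Data.Sum

Component : RootedGraph → RootedGraph
Component G = record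
  { graph = record
      { V = Refinement (V g) (λ x → Reachable g o x)
      ; E = Refinement (E g) (λ e → Reachable g o (ι g e))
      ; ι = λ e → ι g (value e) , proof e
      ; τ = λ e → τ g (value e) , Irr.map (extend g o (value e)) (proof e)
      }
  ; root = o , [ nil ]
  }
  where
    g = graph G
    o = root G

_⊗_ : Graph → Graph → Graph
Γ ⊗ Δ = record
  { V = V Γ × V Δ
  ; E = E Γ × E Δ
  ; ι = λ p → ι Γ (proj₁ p) , ι Δ (proj₂ p)
  ; τ = λ p → τ Γ (proj₁ p) , τ Δ (proj₂ p)
  }

_⊗ᵣ_ : RootedGraph → RootedGraph → RootedGraph
G ⊗ᵣ H = record { graph = graph G ⊗ graph H ; root = root G , root H }

-- Convergence in the space of connected rooted oriented graphs with the
-- metric d = 1/(1+r): d(G n, G) → 0 iff for every radius r the balls of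
-- radius r are eventually isomorphic as rooted oriented graphs.

IsConnectedRooted : RootedGraph → Set
IsConnectedRooted G = Connected (graph G)

_⟶_ : (ℕ → RootedGraph) → RootedGraph → Set
Gs ⟶ G = ∀ r → ∃ λ N → ∀ n → N ≤ n → Ball r (Gs n) ≅ Ball r G

_⟶₂_ : (ℕ → ℕ → RootedGraph) → RootedGraph → Set
Gs ⟶₂ G = ∀ r → ∃ λ N → ∀ n m → N ≤ n → N ≤ m → Ball r (Gs n m) ≅ Ball r G

-- Both sides of the convergence statements are balls of components of tensor
-- products, and the r-ball around (v, w) in the component of (v, w) in Γ ⊗ Δ
-- depends only on the r-balls around v and w: a walk of length ≤ r from the
-- root projects to walks of length ≤ r in each factor, so that ball is also
-- the r-ball of (Ball r Γ ⊗ Ball r Δ). Hence once the balls of the factors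
-- are isomorphic, so are the balls of the products.
module Submission where

open import Defs
open import Data.Nat using (ℕ; suc; _≤_; _⊔_)
open import Data.Nat.Properties using (<⇒≤; ≤-refl; ≤-trans; m≤m⊔n; m≤n⊔m)
open import Data.Product using (_×_; _,_; proj₁; proj₂)
open import Data.Product.Function.NonDependent.Propositional using (_×-↔_)
open import Data.Sum using (inj₁; inj₂)
open import Data.Irrelevant using ([_])
open import Data.Refinement using (value; _,_; value-injective)
open import Function using (_∘′_)
open import Function.Bundles using (Inverse; mk↔ₛ′)
open import Function.Properties.Inverse using (↔-refl; ↔-sym; ↔-trans)
open import Relation.Binary.PropositionalEquality

record Hom (X Y : Graph) : Set where
  field
    onV    : V X → V Y
    onE    : E X → E Y
    ι-comm : ∀ e → ι Y (onE e) ≡ onV (ι X e)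
    τ-comm : ∀ e → τ Y (onE e) ≡ onV (τ X e)
open Hom

_∘ʰ_ : ∀ {X Y Z} → Hom Y Z → Hom X Y → Hom X Z
g ∘ʰ f = record
  { onV = λ x → onV g (onV f x)
  ; onE = λ e → onE g (onE f e)
  ; ι-comm = λ e → trans (ι-comm g (onE f e)) (cong (onV g) (ι-comm f e))
  ; τ-comm = λ e → trans (τ-comm g (onE f e)) (cong (onV g) (τ-comm f e))
  }

mapStep : ∀ {X Y} (f : Hom X Y) {a b} → Step X a b → Step Y (onV f a) (onV f b)
mapStep f (e , inj₁ (refl , refl)) = onE f e , inj₁ (ι-comm f e , τ-comm f e)
mapStep f (e , inj₂ (refl , refl)) = onE f e , inj₂ (τ-comm f e , ι-comm f e)

mapWalk : ∀ {X Y} (f : Hom X Y) {a b} → Walk X a b → Walk Y (onV f a) (onV f b)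
mapWalk f nil        = nil
mapWalk f (snoc w s) = snoc (mapWalk f w) (mapStep f s)

length-mapWalk : ∀ {X Y} (f : Hom X Y) {a b} (w : Walk X a b) → length (mapWalk f w) ≡ length w
length-mapWalk f nil        = refl
length-mapWalk f (snoc w s) = cong suc (length-mapWalk f w)

mapDistLE : ∀ {X Y} (f : Hom X Y) {a b r} → DistLE X a b r → DistLE Y (onV f a) (onV f b) r
mapDistLE f {r = r} (w , le) = mapWalk f w , subst (_≤ r) (sym (length-mapWalk f w)) le

ballInclusion : ∀ r X → Hom (graph (Ball r X)) (graph X)
ballInclusion r X = record { onV = value ; onE = value ; ι-comm = λ _ → refl ; τ-comm = λ _ → refl }

componentInclusion : ∀ X → Hom (graph (Component X)) (graph X)
componentInclusion X = record { onV = value ; onE = value ; ι-comm = λ _ → refl ; τ-comm = λ _ → refl }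

π₁ : ∀ A B → Hom (A ⊗ B) A
π₁ A B = record { onV = proj₁ ; onE = proj₁ ; ι-comm = λ _ → refl ; τ-comm = λ _ → refl }

π₂ : ∀ A B → Hom (A ⊗ B) B
π₂ A B = record { onV = proj₂ ; onE = proj₂ ; ι-comm = λ _ → refl ; τ-comm = λ _ → refl }

_⊗ʰ_ : ∀ {A A′ B B′} → Hom A A′ → Hom B B′ → Hom (A ⊗ B) (A′ ⊗ B′)
f ⊗ʰ g = record
  { onV = λ p → onV f (proj₁ p) , onV g (proj₂ p)
  ; onE = λ p → onE f (proj₁ p) , onE g (proj₂ p)
  ; ι-comm = λ p → cong₂ _,_ (ι-comm f (proj₁ p)) (ι-comm g (proj₂ p))
  ; τ-comm = λ p → cong₂ _,_ (τ-comm f (proj₁ p)) (τ-comm g (proj₂ p))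
  }

module _ {X : RootedGraph} {r : ℕ} where
  private
    g = graph X
    o = root X

  liftWalk : ∀ {x} (w : Walk g o x) (le : length w ≤ r) →
             Walk (graph (Ball r X)) (root (Ball r X)) (x , [ w , le ])
  liftWalk nil le = nil
  liftWalk (snoc w s@(e , inj₁ (refl , refl))) le =
    snoc (liftWalk w (<⇒≤ le)) ((e , [ (w , <⇒≤ le) , (snoc w s , le) ]) , inj₁ (refl , refl))
  liftWalk (snoc w s@(e , inj₂ (refl , refl))) le =
    snoc (liftWalk w (<⇒≤ le)) ((e , [ (snoc w s , le) , (w , <⇒≤ le) ]) , inj₂ (refl , refl))

  length-liftWalk : ∀ {x} (w : Walk g o x) (le : length w ≤ r) → length (liftWalk w le) ≡ length w
  length-liftWalk nil le = refl
  length-liftWalk (snoc w (e , inj₁ (refl , refl))) le = cong suc (length-liftWalk w (<⇒≤ le))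
  length-liftWalk (snoc w (e , inj₂ (refl , refl))) le = cong suc (length-liftWalk w (<⇒≤ le))

  DistLE-ball : ∀ {x} (d : DistLE g o x r) → DistLE (graph (Ball r X)) (root (Ball r X)) (x , [ d ]) r
  DistLE-ball (w , le) = liftWalk w le , subst (_≤ r) (sym (length-liftWalk w le)) le

module BallMap {X Y : RootedGraph} {r : ℕ}
               (f : Hom (graph (Ball r X)) (graph Y)) (f-root : onV f (root (Ball r X)) ≡ root Y) where

  DistLE-image : ∀ {x} (d : DistLE (graph X) (root X) x r) → DistLE (graph Y) (root Y) (onV f (x , [ d ])) r
  DistLE-image {x} d =
    subst (λ y → DistLE (graph Y) y (onV f (x , [ d ])) r) f-root (mapDistLE f (DistLE-ball d))

  vertex : V (graph (Ball r X)) → V (graph (Ball r Y))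
  vertex x@(_ , [ d ]) = onV f x , [ DistLE-image d ]

  edge : E (graph (Ball r X)) → E (graph (Ball r Y))
  edge e@(_ , [ d ]) =
    onE f e , [ at (ι-comm f e) (DistLE-image (proj₁ d)) , at (τ-comm f e) (DistLE-image (proj₂ d)) ]
    where
      at : ∀ {y z} → y ≡ z → DistLE (graph Y) (root Y) z r → DistLE (graph Y) (root Y) y r
      at eq = subst (λ y → DistLE (graph Y) (root Y) y r) (sym eq)

ballIso : ∀ {X Y r}
  (f : Hom (graph (Ball r X)) (graph Y)) (f-root : onV f (root (Ball r X)) ≡ root Y)
  (g : Hom (graph (Ball r Y)) (graph X)) (g-root : onV g (root (Ball r Y)) ≡ root X) →
  (∀ x → onV g (BallMap.vertex f f-root x) ≡ value x) →
  (∀ y → onV f (BallMap.vertex g g-root y) ≡ value y) →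
  (∀ e → onE g (BallMap.edge f f-root e) ≡ value e) →
  (∀ e → onE f (BallMap.edge g g-root e) ≡ value e) →
  Ball r X ≅ Ball r Y
ballIso f f-root g g-root gf-V fg-V gf-E fg-E = record
  { vIso = mk↔ₛ′ F.vertex G.vertex (λ y → value-injective (fg-V y)) (λ x → value-injective (gf-V x))
  ; eIso = mk↔ₛ′ F.edge G.edge (λ e → value-injective (fg-E e)) (λ e → value-injective (gf-E e))
  ; ι-hom = λ e → value-injective (ι-comm f e)
  ; τ-hom = λ e → value-injective (τ-comm f e)
  ; root-hom = value-injective f-root
  }
  where
    module F = BallMap f f-root
    module G = BallMap g g-root

≅-refl : ∀ {X} → X ≅ X
≅-refl = record
  { vIso = ↔-refl ; eIso = ↔-refl ; ι-hom = λ _ → refl ; τ-hom = λ _ → refl ; root-hom = refl }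

module _ {X Y : RootedGraph} (i : X ≅ Y) where
  open _≅_ i
  private
    module IV = Inverse vIso
    module IE = Inverse eIso

  ≅⇒Hom : Hom (graph X) (graph Y)
  ≅⇒Hom = record { onV = IV.to ; onE = IE.to ; ι-comm = ι-hom ; τ-comm = τ-hom }

  ≅-sym : Y ≅ X
  ≅-sym = record
    { vIso = ↔-sym vIso ; eIso = ↔-sym eIso
    ; ι-hom = from-comm (ι (graph X)) (ι (graph Y)) ι-hom
    ; τ-hom = from-comm (τ (graph X)) (τ (graph Y)) τ-hom
    ; root-hom = begin
        IV.from (root Y)           ≡⟨ cong IV.from (sym root-hom) ⟩
        IV.from (IV.to (root X))   ≡⟨ IV.strictlyInverseʳ (root X) ⟩
        root X                     ∎
    }
    where
      open ≡-Reasoning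
      from-comm : (s : E (graph X) → V (graph X)) (t : E (graph Y) → V (graph Y)) →
                  (∀ e → t (IE.to e) ≡ IV.to (s e)) → ∀ e → s (IE.from e) ≡ IV.from (t e)
      from-comm s t comm e = begin
        s (IE.from e)                  ≡⟨ IV.strictlyInverseʳ _ ⟨
        IV.from (IV.to (s (IE.from e))) ≡⟨ cong IV.from (comm (IE.from e)) ⟨
        IV.from (t (IE.to (IE.from e))) ≡⟨ cong (IV.from ∘′ t) (IE.strictlyInverseˡ e) ⟩
        IV.from (t e)                   ∎

≅-trans : ∀ {X Y Z} → X ≅ Y → Y ≅ Z → X ≅ Z
≅-trans i j = record
  { vIso = ↔-trans (vIso i) (vIso j) ; eIso = ↔-trans (eIso i) (eIso j)
  ; ι-hom = ι-comm (≅⇒Hom j ∘ʰ ≅⇒Hom i)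
  ; τ-hom = τ-comm (≅⇒Hom j ∘ʰ ≅⇒Hom i)
  ; root-hom = trans (cong (Inverse.to (vIso j)) (root-hom i)) (root-hom j)
  }
  where open _≅_

⊗ᵣ-cong : ∀ {A A′ B B′} → A ≅ A′ → B ≅ B′ → (A ⊗ᵣ B) ≅ (A′ ⊗ᵣ B′)
⊗ᵣ-cong i j = record
  { vIso = vIso i ×-↔ vIso j ; eIso = eIso i ×-↔ eIso j
  ; ι-hom = ι-comm (≅⇒Hom i ⊗ʰ ≅⇒Hom j)
  ; τ-hom = τ-comm (≅⇒Hom i ⊗ʰ ≅⇒Hom j)
  ; root-hom = cong₂ _,_ (root-hom i) (root-hom j)
  }
  where open _≅_

Ball-cong : ∀ {X Y} r → X ≅ Y → Ball r X ≅ Ball r Y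
Ball-cong {X} {Y} r i = ballIso
  (≅⇒Hom i ∘ʰ ballInclusion r X) (_≅_.root-hom i)
  (≅⇒Hom (≅-sym i) ∘ʰ ballInclusion r Y) (_≅_.root-hom (≅-sym i))
  (λ x → IV.strictlyInverseʳ (value x)) (λ y → IV.strictlyInverseˡ (value y))
  (λ e → IE.strictlyInverseʳ (value e)) (λ e → IE.strictlyInverseˡ (value e))
  where
    module IV = Inverse (_≅_.vIso i)
    module IE = Inverse (_≅_.eIso i)

module _ (r : ℕ) (G H : RootedGraph) where
  private
    K = G ⊗ᵣ H
    inK = componentInclusion K
    inG⊗H = ballInclusion r G ⊗ʰ ballInclusion r H

  componentToBalls : Hom (graph (Ball r (Component K))) (graph (Ball r G ⊗ᵣ Ball r H))
  componentToBalls = record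
    { onV = λ { (x , [ d ]) → (proj₁ (value x) , [ toG d ]) , (proj₂ (value x) , [ toH d ]) }
    ; onE = λ { (e , [ d ]) → (proj₁ (value e) , [ toG (proj₁ d) , toG (proj₂ d) ])
                            , (proj₂ (value e) , [ toH (proj₁ d) , toH (proj₂ d) ]) }
    ; ι-comm = λ _ → refl
    ; τ-comm = λ _ → refl
    }
    where
      toG = mapDistLE (π₁ (graph G) (graph H) ∘ʰ inK)
      toH = mapDistLE (π₂ (graph G) (graph H) ∘ʰ inK)

  ballsToComponent : Hom (graph (Ball r (Ball r G ⊗ᵣ Ball r H))) (graph (Component K))
  ballsToComponent = record
    { onV = λ { (x , [ d ]) → onV inG⊗H x , [ proj₁ (mapDistLE inG⊗H d) ] }
    ; onE = λ { (e , [ d ]) → onE inG⊗H e , [ proj₁ (mapDistLE inG⊗H (proj₁ d)) ] }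
    ; ι-comm = λ _ → refl
    ; τ-comm = λ _ → refl
    }

  Ball-Component-⊗ᵣ : Ball r (Component K) ≅ Ball r (Ball r G ⊗ᵣ Ball r H)
  Ball-Component-⊗ᵣ = ballIso componentToBalls refl ballsToComponent refl
    (λ _ → refl) (λ _ → refl) (λ _ → refl) (λ _ → refl)

Ball-Component-⊗ᵣ-cong : ∀ r {G G′ H H′} → Ball r G ≅ Ball r G′ → Ball r H ≅ Ball r H′ →
                          Ball r (Component (G ⊗ᵣ H)) ≅ Ball r (Component (G′ ⊗ᵣ H′))
Ball-Component-⊗ᵣ-cong r {G} {G′} {H} {H′} α β =
  ≅-trans (Ball-Component-⊗ᵣ r G H)
    (≅-trans (Ball-cong r (⊗ᵣ-cong α β)) (≅-sym (Ball-Component-⊗ᵣ r G′ H′)))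

const-⟶ : ∀ G → (λ _ → G) ⟶ G
const-⟶ G r = 0 , λ _ _ → ≅-refl

⟶₂-constʳ : ∀ {Fs F} → (λ n (_ : ℕ) → Fs n) ⟶₂ F → Fs ⟶ F
⟶₂-constʳ conv r = let N , ball≅ = conv r in N , λ n N≤n → ball≅ n N N≤n ≤-refl

⟶₂-constˡ : ∀ {Fs F} → (λ (_ : ℕ) m → Fs m) ⟶₂ F → Fs ⟶ F
⟶₂-constˡ conv r = let N , ball≅ = conv r in N , λ m N≤m → ball≅ N m ≤-refl N≤m

Component-⊗ᵣ-⟶₂ : ∀ {Gs G Hs H} → Gs ⟶ G → Hs ⟶ H →
                   (λ n m → Component (Gs n ⊗ᵣ Hs m)) ⟶₂ Component (G ⊗ᵣ H)
Component-⊗ᵣ-⟶₂ Gs⟶G Hs⟶H r =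
  let NG , ballG≅ = Gs⟶G r
      NH , ballH≅ = Hs⟶H r
  in NG ⊔ NH , λ n m NG⊔NH≤n NG⊔NH≤m →
       Ball-Component-⊗ᵣ-cong r (ballG≅ n (≤-trans (m≤m⊔n NG NH) NG⊔NH≤n))
                                (ballH≅ m (≤-trans (m≤n⊔m NG NH) NG⊔NH≤m))

theorem3p5 : (Γs : ℕ → RootedGraph) (Γ : RootedGraph) (Θs : ℕ → RootedGraph) (Θ : RootedGraph) →
    (∀ n → IsConnectedRooted (Γs n)) → IsConnectedRooted Γ →
    (∀ m → IsConnectedRooted (Θs m)) → IsConnectedRooted Θ →
    Γs ⟶ Γ → Θs ⟶ Θ →
    (∀ m → (λ n → Component (Γs n ⊗ᵣ Θs m)) ⟶ Component (Γ ⊗ᵣ Θs m))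
    × (∀ n → (λ m → Component (Γs n ⊗ᵣ Θs m)) ⟶ Component (Γs n ⊗ᵣ Θ))
    × ((λ m → Component (Γ ⊗ᵣ Θs m)) ⟶ Component (Γ ⊗ᵣ Θ))
    × ((λ n → Component (Γs n ⊗ᵣ Θ)) ⟶ Component (Γ ⊗ᵣ Θ))
    × ((λ n m → Component (Γs n ⊗ᵣ Θs m)) ⟶₂ Component (Γ ⊗ᵣ Θ))
theorem3p5 Γs Γ Θs Θ _ _ _ _ Γs⟶Γ Θs⟶Θ =
    (λ m → ⟶₂-constʳ (Component-⊗ᵣ-⟶₂ Γs⟶Γ (const-⟶ (Θs m))))
  , (λ n → ⟶₂-constˡ (Component-⊗ᵣ-⟶₂ (const-⟶ (Γs n)) Θs⟶Θ))
  , ⟶₂-constˡ (Component-⊗ᵣ-⟶₂ (const-⟶ Γ) Θs⟶Θ)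
  , ⟶₂-constʳ (Component-⊗ᵣ-⟶₂ Γs⟶Γ (const-⟶ Θ))
  , Component-⊗ᵣ-⟶₂ Γs⟶Γ Θs⟶Θ
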